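{- Let $m\ge1$, let $\epsilon=(\epsilon_1,\dots,\epsilon_s)$ be a circular sequence with $\epsilon_i\in\{1,-1\}$ for all $i$, and let $x_{l_1,t_1},x_{l_2,t_2},\dots,x_{l_n,t_n}$ be a free linear digraph of $\Gamma^m_\epsilon$ listed from its origin $x_{l_1,t_1}$ to its terminal $x_{l_n,t_n}$. Then $\epsilon_{t_1}=-1$, $\epsilon_{t_n}=1$, and $l_1=l_n=m-1$.
   Context: Indices are mod $s$. Digraph $\Gamma^m_\epsilon$: vertices $x_{i,t}$, $0\le i\le m-1$, $t\in\{1,\dots,s\}$, some "marked zero". If $s=1$: all vertices are marked zero, no edges. If $s\ge2$: for each $t$ let $A_t=\max(\epsilon_t,0)$, $B_t=\max(-\epsilon_{t+1},0)$; for each $j\in\{0,\dots,m-1\}$: if $j\ge\max(A_t,B_t)$ add an edge from $x_{j-A_t,t}$ to $x_{j-B_t,t+1}$ of weight $A_t-B_t$; if $A_t\le j<B_t$ mark $x_{j-A_t,t}$ zero; if $B_t\le j<A_t$ mark $x_{j-B_t,t+1}$ zero. Each connected component is a directed path (linear digraph, possibly a single vertex; its origin is the vertex that is not a target and its terminal the vertex that is not a source) or a directed cycle; a linear digraph with no vertex marked zero is a free linear digraph. -}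

module Defs where

open import Data.Nat using (ℕ; zero; suc; _≤_; _<_; _∸_; _+_)
open import Data.Nat.DivMod using (_%_; m%n<n)
open import Data.Fin using (Fin; toℕ; fromℕ<; fromℕ; inject₁)
open import Data.Integer using (ℤ; +_; -_; _⊔_; ∣_∣) renaming (_-_ to _-ℤ_)
open import Data.Product using (Σ; _×_; _,_)
open import Data.Sum using (_⊎_)
open import Relation.Binary.PropositionalEquality using (_≡_)
open import Relation.Nullary using (¬_)

-- Positions t ∈ {1,…,s} are represented by Fin s (t ↦ t-1); indices are mod s.
next : ∀ {s} → Fin s → Fin s
next {suc k} t = fromℕ< (m%n<n (suc (toℕ t)) (suc k))

Aₜ : ∀ {s} → (Fin s → ℤ) → Fin s → ℕ
Aₜ ε t = ∣ ε t ⊔ + 0 ∣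

Bₜ : ∀ {s} → (Fin s → ℤ) → Fin s → ℕ
Bₜ ε t = ∣ (- ε (next t)) ⊔ + 0 ∣

Vertex : ℕ → ℕ → Set
Vertex m s = Fin m × Fin s

WEdge : ∀ {m s} → (Fin s → ℤ) → Vertex m s → Vertex m s → ℤ → Set
WEdge {m} {s} ε (i , t) (i' , t') w =
  2 ≤ s × Σ ℕ λ j → j < m × Aₜ ε t ≤ j × Bₜ ε t ≤ j
    × toℕ i ≡ j ∸ Aₜ ε t × t' ≡ next t × toℕ i' ≡ j ∸ Bₜ ε t
    × w ≡ (+ Aₜ ε t) -ℤ (+ Bₜ ε t)

Edge : ∀ {m s} → (Fin s → ℤ) → Vertex m s → Vertex m s → Set
Edge ε u v = Σ ℤ λ w → WEdge ε u v w

MarkedZero : ∀ {m s} → (Fin s → ℤ) → Vertex m s → Set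
MarkedZero {m} {s} ε (i , t') =
  s ≡ 1 ⊎
  (2 ≤ s × Σ (Fin s) λ t → Σ ℕ λ j → j < m ×
     ((Aₜ ε t ≤ j × j < Bₜ ε t × toℕ i ≡ j ∸ Aₜ ε t × t' ≡ t)
     ⊎ (Bₜ ε t ≤ j × j < Aₜ ε t × toℕ i ≡ j ∸ Bₜ ε t × t' ≡ next t)))

-- p 0, …, p n is a free linear digraph (connected component which is a
-- directed path with no vertex marked zero), listed from its origin p 0
-- to its terminal p n.
record FreeLinearListing {m s : ℕ} (ε : Fin s → ℤ) (n : ℕ)
                         (p : Fin (suc n) → Vertex m s) : Set where
  field
    distinct    : ∀ a b → p a ≡ p b → a ≡ b
    consecutive : ∀ (k : Fin n) → Edge ε (p (inject₁ k)) (p (Fin.suc k))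
    closedOut   : ∀ a v → Edge ε (p a) v → Σ (Fin (suc n)) λ b → p b ≡ v
    closedIn    : ∀ a u → Edge ε u (p a) → Σ (Fin (suc n)) λ b → p b ≡ u
    originNotTarget  : ∀ u → ¬ Edge ε u (p Fin.zero)
    terminalNotSource : ∀ v → ¬ Edge ε (p (fromℕ n)) v
    noZero      : ∀ a → ¬ MarkedZero ε (p a)

module Submission where

-- Write j = A_t + i.  Whenever j < m, step t either produces an
-- edge out of x_{i,t} (if B_t ≤ j) or marks x_{i,t} zero (if j < B_t); this
-- holds for every sequence ε.  Dually, whenever B_u + i < m, step u either
-- produces an edge into x_{i,u+1} or marks it zero.  The terminal of a free
-- linear digraph has no outgoing edge and no zero mark, so A_t + l_n ≥ m; the
-- origin has no incoming edge and no zero mark, so B_u + l_1 ≥ m where u + 1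
-- is the position of the origin.  For ε_i ∈ {±1} both A_t = max(ε_t, 0) and
-- B_u = max(-ε_{u+1}, 0) are at most 1, and an index l < m with m ≤ 1 + l is
-- l = m - 1; so the bound forces the relevant maximum to be 1, which pins down
-- the sign.

open import Defs
open import Data.Nat using (ℕ; suc; zero; _≤_; _<_; _∸_; _+_; _≤?_; s≤s; z≤n)
open import Data.Nat.Properties
  using (≤-antisym; ≤-<-trans; <⇒≱; ≰⇒>; ≮⇒≥; m≤m+n; m∸n≤m; m+n∸m≡n)
open import Data.Nat.DivMod using (_%_; n%n≡0; m<n⇒m%n≡m)
open import Data.Fin using (Fin; toℕ; fromℕ; fromℕ<; inject₁)
open import Data.Fin.Properties
  using (toℕ-injective; toℕ-fromℕ<; toℕ<n; toℕ-fromℕ; toℕ-inject₁)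
open import Data.Integer using (ℤ; +_; -[1+_]; -_; _⊔_; ∣_∣)
open import Data.Integer.Properties using (neg-involutive)
open import Data.Product using (Σ; _×_; _,_; proj₁; proj₂)
open import Data.Sum using (_⊎_; inj₁; inj₂; [_,_]′)
open import Data.Empty using (⊥-elim)
open import Relation.Nullary using (¬_; yes; no)
open import Relation.Binary.PropositionalEquality
  using (_≡_; refl; sym; trans; cong; module ≡-Reasoning)

Sign : ℤ → Set
Sign x = x ≡ + 1 ⊎ x ≡ -[1+ 0 ]

sign-neg : ∀ {x} → Sign x → Sign (- x)
sign-neg (inj₁ refl) = inj₂ refl
sign-neg (inj₂ refl) = inj₁ refl

neg≡1⇒≡-1 : ∀ {x} → - x ≡ + 1 → x ≡ -[1+ 0 ]
neg≡1⇒≡-1 {x} -x≡1 = trans (sym (neg-involutive x)) (cong -_ -x≡1)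

last-index : ∀ {i m} → i < m → m ≤ suc i → i ≡ m ∸ 1
last-index i<m m≤1+i = cong (_∸ 1) (≤-antisym i<m m≤1+i)

overflow-at-boundary : ∀ {x i m} → Sign x → i < m → m ≤ ∣ x ⊔ + 0 ∣ + i
  → x ≡ + 1 × i ≡ m ∸ 1
overflow-at-boundary (inj₁ refl) i<m m≤1+i = refl , last-index i<m m≤1+i
overflow-at-boundary (inj₂ refl) i<m m≤i   = ⊥-elim (<⇒≱ i<m m≤i)

-- The successor map t ↦ t + 1 (mod s) is surjective, so every position has a
-- predecessor step; needed to locate the step that could end at the origin.
toℕ-next : ∀ {k} (t : Fin (suc k)) → toℕ (next t) ≡ suc (toℕ t) % suc k
toℕ-next t = toℕ-fromℕ< _

next-surjective : ∀ {k} (t : Fin (suc k)) → Σ (Fin (suc k)) λ u → next u ≡ t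
next-surjective {k} Fin.zero = fromℕ k , toℕ-injective (begin
  toℕ (next (fromℕ k))          ≡⟨ toℕ-next (fromℕ k) ⟩
  suc (toℕ (fromℕ k)) % suc k   ≡⟨ cong (λ a → suc a % suc k) (toℕ-fromℕ k) ⟩
  suc k % suc k                 ≡⟨ n%n≡0 (suc k) ⟩
  0                             ∎)
  where open ≡-Reasoning
next-surjective {suc k} (Fin.suc t) = inject₁ t , toℕ-injective (begin
  toℕ (next (inject₁ t))              ≡⟨ toℕ-next (inject₁ t) ⟩
  suc (toℕ (inject₁ t)) % suc (suc k) ≡⟨ cong (λ a → suc a % suc (suc k)) (toℕ-inject₁ t) ⟩
  suc (toℕ t) % suc (suc k)           ≡⟨ m<n⇒m%n≡m (s≤s (toℕ<n t)) ⟩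
  suc (toℕ t)                         ∎)
  where open ≡-Reasoning

module _ {m s : ℕ} (ε : Fin s → ℤ) (s≥2 : 2 ≤ s) where

  shifted : (j c : ℕ) → j < m → Fin m
  shifted j c j<m = fromℕ< (≤-<-trans (m∸n≤m j c) j<m)

  toℕ-shifted : ∀ j c (j<m : j < m) → toℕ (shifted j c j<m) ≡ j ∸ c
  toℕ-shifted j c j<m = toℕ-fromℕ< _

  source-or-zero : (i : Fin m) (t : Fin s) → Aₜ ε t + toℕ i < m
    → (Σ (Vertex m s) λ v → Edge ε (i , t) v) ⊎ MarkedZero ε (i , t)
  source-or-zero i t j<m with Bₜ ε t ≤? Aₜ ε t + toℕ i
  ... | yes B≤j = inj₁ ((shifted j (Bₜ ε t) j<m , next t) , _
        , s≥2 , j , j<m , m≤m+n (Aₜ ε t) (toℕ i) , B≤j , sym (m+n∸m≡n (Aₜ ε t) (toℕ i)) , refl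
        , toℕ-shifted j (Bₜ ε t) j<m , refl)
    where j = Aₜ ε t + toℕ i
  ... | no B≰j = inj₂ (inj₂ (s≥2 , t , _ , j<m
        , inj₁ (m≤m+n (Aₜ ε t) (toℕ i) , ≰⇒> B≰j , sym (m+n∸m≡n (Aₜ ε t) (toℕ i)) , refl)))

  target-or-zero : (i : Fin m) (u : Fin s) → Bₜ ε u + toℕ i < m
    → (Σ (Vertex m s) λ v → Edge ε v (i , next u)) ⊎ MarkedZero ε (i , next u)
  target-or-zero i u j<m with Aₜ ε u ≤? Bₜ ε u + toℕ i
  ... | yes A≤j = inj₁ ((shifted j (Aₜ ε u) j<m , u) , _
        , s≥2 , j , j<m , A≤j , m≤m+n (Bₜ ε u) (toℕ i) , toℕ-shifted j (Aₜ ε u) j<m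
        , refl , sym (m+n∸m≡n (Bₜ ε u) (toℕ i)) , refl)
    where j = Bₜ ε u + toℕ i
  ... | no A≰j = inj₂ (inj₂ (s≥2 , u , _ , j<m
        , inj₂ (m≤m+n (Bₜ ε u) (toℕ i) , ≰⇒> A≰j , sym (m+n∸m≡n (Bₜ ε u) (toℕ i)) , refl)))

  terminal-shape : (v : Vertex m s) → Sign (ε (proj₂ v))
    → (∀ w → ¬ Edge ε v w) → ¬ MarkedZero ε v
    → ε (proj₂ v) ≡ + 1 × toℕ (proj₁ v) ≡ m ∸ 1
  terminal-shape (i , t) sign noOut noZero =
    overflow-at-boundary sign (toℕ<n i) (≮⇒≥ λ j<m →
      [ (λ (w , e) → noOut w e) , noZero ]′ (source-or-zero i t j<m))

  origin-shape : (v : Vertex m s) (u : Fin s) → next u ≡ proj₂ v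
    → Sign (ε (proj₂ v)) → (∀ w → ¬ Edge ε w v) → ¬ MarkedZero ε v
    → ε (proj₂ v) ≡ -[1+ 0 ] × toℕ (proj₁ v) ≡ m ∸ 1
  origin-shape (i , _) u refl sign noIn noZero with
    overflow-at-boundary (sign-neg sign) (toℕ<n i) (≮⇒≥ λ j<m →
      [ (λ (w , e) → noIn w e) , noZero ]′ (target-or-zero i u j<m))
  ... | -ε≡1 , last = neg≡1⇒≡-1 -ε≡1 , last

-- For s = 1 every vertex is marked zero, so no free linear digraph exists;
-- for s ≥ 2 the origin and terminal shapes give the four claims.
lemma4p1 : (m s : ℕ) → 1 ≤ m → 1 ≤ s → (ε : Fin s → ℤ)
    → (∀ i → ε i ≡ + 1 ⊎ ε i ≡ -[1+ 0 ])
    → (n : ℕ) (p : Fin (suc n) → Vertex m s) → FreeLinearListing ε n p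
    → ε (proj₂ (p Fin.zero)) ≡ -[1+ 0 ] × ε (proj₂ (p (fromℕ n))) ≡ + 1
      × toℕ (proj₁ (p Fin.zero)) ≡ m ∸ 1 × toℕ (proj₁ (p (fromℕ n))) ≡ m ∸ 1
lemma4p1 m (suc zero) _ _ ε _ n p F = ⊥-elim (noZero Fin.zero (inj₁ refl))
  where open FreeLinearListing F
lemma4p1 m (suc (suc k)) _ _ ε sign n p F =
  proj₁ origin , proj₁ terminal , proj₂ origin , proj₂ terminal
  where
    open FreeLinearListing F
    2≤s : 2 ≤ suc (suc k)
    2≤s = s≤s (s≤s z≤n)
    predecessor : Σ (Fin (suc (suc k))) λ u → next u ≡ proj₂ (p Fin.zero)
    predecessor = next-surjective (proj₂ (p Fin.zero))
    origin : ε (proj₂ (p Fin.zero)) ≡ -[1+ 0 ] × toℕ (proj₁ (p Fin.zero)) ≡ m ∸ 1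
    origin = origin-shape ε 2≤s (p Fin.zero) (proj₁ predecessor) (proj₂ predecessor)
      (sign _) originNotTarget (noZero Fin.zero)
    terminal : ε (proj₂ (p (fromℕ n))) ≡ + 1 × toℕ (proj₁ (p (fromℕ n))) ≡ m ∸ 1
    terminal = terminal-shape ε 2≤s (p (fromℕ n)) (sign _) terminalNotSource (noZero (fromℕ n))
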